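{- Let $C$ be a cycle and $P=v_1v_2\cdots v_k$ a path disjoint from $C$ with $k\ge3$, and let $G$ be obtained from the disjoint union of $C$ and $P$ by adding the edges $v_1x$ and $v_ky$, where $x,y$ are (not necessarily distinct) vertices of $C$. If $G$ is not isomorphic to $C_4\cdot C_4$ or $G_1$, then $G$ is configurable.
   Context: $C_4\cdot C_4$ is the graph obtained from two disjoint $4$-cycles by identifying a vertex of the first with a vertex of the second. $G_1$ is the graph obtained from a $7$-cycle $v_0v_1\cdots v_6v_0$ by adding the chord $v_2v_5$. $[5]^2$ is the set of $2$-element subsets of $\{1,2,3,4,5\}$. A configuration on a graph $G$ is a map $f:V(G)\to[5]^2$ with $\bigcup_{u\in N[v]} f(u)=\{1,2,3,4,5\}$ for every vertex $v$, where $N[v]$ is the closed neighborhood; $G$ is configurable if it has a configuration. -}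

module Defs where

open import Data.Nat using (ℕ; zero; suc; _+_; _∸_; _≡ᵇ_; _<ᵇ_; _≤ᵇ_; _≤_)
open import Data.Bool using (Bool; true; false; _∧_; _∨_; if_then_else_)
open import Data.Fin using (Fin; toℕ)
open import Data.Fin.Subset using (Subset; ∣_∣; _∈_)
open import Data.List using (List; []; _∷_)
open import Data.Bool.ListAction using (any)
open import Data.Product using (_×_; _,_; Σ; ∃; ∃-syntax)
open import Data.Sum using (_⊎_)
open import Relation.Binary.PropositionalEquality using (_≡_)
open import Function.Bundles using (_⤖_; Bijection)

record Graph : Set where
  field
    n   : ℕ
    adj : Fin n → Fin n → Bool
open Graph public

fromEdgeFun : (n : ℕ) → (ℕ → ℕ → Bool) → Graph
fromEdgeFun n E = record { n = n ; adj = λ u v → E (toℕ u) (toℕ v) ∨ E (toℕ v) (toℕ u) }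

fromEdgeList : (n : ℕ) → List (ℕ × ℕ) → Graph
fromEdgeList n es = fromEdgeFun n (λ i j → any (λ { (a , b) → (a ≡ᵇ i) ∧ (b ≡ᵇ j) }) es)

_≅_ : Graph → Graph → Set
G ≅ H = Σ (Fin (n G) ⤖ Fin (n H)) λ σ →
          ∀ u v → adj G u v ≡ adj H (Bijection.to σ u) (Bijection.to σ v)

-- C₄·C₄ : two 4-cycles 0-1-2-3-0 and 0-4-5-6-0 sharing vertex 0.
C4·C4 : Graph
C4·C4 = fromEdgeList 7
  ((0 , 1) ∷ (1 , 2) ∷ (2 , 3) ∷ (3 , 0) ∷ (0 , 4) ∷ (4 , 5) ∷ (5 , 6) ∷ (6 , 0) ∷ [])

-- G₁ : 7-cycle v0 v1 ... v6 v0 plus the chord v2 v5.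
G₁ : Graph
G₁ = fromEdgeList 7
  ((0 , 1) ∷ (1 , 2) ∷ (2 , 3) ∷ (3 , 4) ∷ (4 , 5) ∷ (5 , 6) ∷ (6 , 0) ∷ (2 , 5) ∷ [])

-- Vertex set Fin (m + k):
--   indices 0 … m-1 are the cycle C = c₀ c₁ … c_{m-1} c₀,
--   indices m … m+k-1 are the path P = v₁ … v_k (v_j has index m + j - 1),
--   plus edges v₁x and v_k y, where x y : Fin m are cycle vertices.
cycPathEdge : (m k : ℕ) → Fin m → Fin m → ℕ → ℕ → Bool
cycPathEdge m k x y i j =
     ((i <ᵇ m) ∧ (j ≡ᵇ (if suc i ≡ᵇ m then 0 else suc i)))
  ∨ ((m ≤ᵇ i) ∧ (j ≡ᵇ suc i) ∧ (j <ᵇ (m + k)))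
  ∨ ((i ≡ᵇ m) ∧ (j ≡ᵇ toℕ x))
  ∨ ((i ≡ᵇ (m + k ∸ 1)) ∧ (j ≡ᵇ toℕ y))

CycPath : (m k : ℕ) → Fin m → Fin m → Graph
CycPath m k x y = fromEdgeFun (m + k) (cycPathEdge m k x y)

-- [5]² : 2-element subsets of {1,…,5} (represented as subsets of Fin 5).
TwoSubset : Set
TwoSubset = Σ (Subset 5) λ s → ∣ s ∣ ≡ 2

IsConfiguration : (G : Graph) → (Fin (n G) → TwoSubset) → Set
IsConfiguration G f =
  ∀ (v : Fin (n G)) (c : Fin 5) →
    ∃[ u ] ((u ≡ v ⊎ adj G v u ≡ true) × c ∈ Data.Product.proj₁ (f u))

Configurable : Graph → Set
Configurable G = ∃[ f ] IsConfiguration G f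

module Submission where

-- A vertex is satisfied once it and two of its closed neighbours carry labels whose union is [5], so
-- it suffices to label the cycle and the path by words in which any three consecutive labels cover
-- [5]. The word 12 34 15 23 45 repeated has this property, and keeps it when blocks 12 34 15 are put
-- in front; as every m ≥ 3 other than 4 and 7 is a sum of 5s and 3s, such a word labels the cycle.
-- The path continues the periodic word from the label of x and ends with a three-letter tail, found
-- by exhaustive search, that joins it to the label of y. For m ∈ {4, 7} a fixed cycle word, rotated
-- to put 12 at x, fails only at x, which the first path vertex repairs; if moreover k = 3 the path
-- labels are found by search, and for m = 4 the twelve graphs where no labels exist are isomorphic
-- to C₄·C₄ or G₁.

open import Defs
open import Data.Bool using (Bool; true; false; T; _∧_; _∨_; if_then_else_)
open import Data.Bool.Properties using (T-∨; T-∧; T-≡) renaming (_≟_ to _≟ᴮ_)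
open import Data.Nat using (ℕ; zero; suc; _+_; _*_; _∸_; _≤_; _<_; _<?_; _≡ᵇ_; _<ᵇ_; _≤ᵇ_; z≤n; s≤s; z<s; NonZero)
open import Data.Nat.Properties
  using (≡⇒≡ᵇ; ≡ᵇ⇒≡; <⇒<ᵇ; ≤⇒≤ᵇ; <ᵇ⇒<; <-irrefl; n≮n; <-≤-trans; ≤-trans; <-trans; <⇒≤; ≤-pred; ≮⇒≥;
         n<1+n; m≤m+n; m≤n⇒m<n∨m≡n; +-comm; +-assoc; +-suc; +-identityʳ; +-monoʳ-<; +-monoʳ-≤;
         +-cancelˡ-<; m+n≮m; m+n∸m≡n; m+[n∸m]≡n; anyUpTo?; allUpTo?)
  renaming (_≟_ to _≟ℕ_)
open import Data.Nat.DivMod using (_mod_)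
open import Data.Nat.GeneralisedArithmetic using (fold; fold-+)
open import Data.Fin using (Fin; toℕ; fromℕ<; _≟_)
open import Data.Fin.Patterns using (0F; 1F; 2F; 3F; 4F; 5F; 6F; 7F; 8F; 9F)
open import Data.Fin.Properties using (toℕ-fromℕ<; toℕ-injective; toℕ<n; all?; any?)
open import Data.Fin.Subset using (Subset; inside; outside; _∈_; _∪_; ⊤; ∣_∣)
open import Data.Fin.Subset.Properties using (_⊆?_; ∈⊤; x∈p∪q⁻)
open import Data.Vec using (Vec; []; _∷_; lookup)
open import Data.Product using (∃; ∃₂; _×_; _,_; proj₁)
open import Data.Sum using (_⊎_; inj₁; inj₂)
import Data.Sum as Sum
open import Function using (_∘_)
open import Function.Bundles using (Equivalence; mk⤖)
open import Function.Consequences.Propositional using (strictlySurjective⇒surjective)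
open import Relation.Nullary using (¬_; Dec; yes; no; contradiction)
open import Relation.Nullary.Decidable using (True; T?; toWitness; from-yes; map′; _×-dec_; _⊎-dec_; _→-dec_)
open import Relation.Binary.PropositionalEquality
  using (_≡_; refl; sym; trans; cong; subst; subst₂; module ≡-Reasoning)

-- The ten elements of [5]², in lexicographic order; lᵢⱼ is {i, j}.
Label : Set
Label = Fin 10

pattern l12 = 0F
pattern l13 = 1F
pattern l14 = 2F
pattern l15 = 3F
pattern l23 = 4F
pattern l24 = 5F
pattern l25 = 6F
pattern l34 = 7F
pattern l35 = 8F
pattern l45 = 9F

colours : Label → Subset 5
colours l12 = inside  ∷ inside  ∷ outside ∷ outside ∷ outside ∷ []
colours l13 = inside  ∷ outside ∷ inside  ∷ outside ∷ outside ∷ []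
colours l14 = inside  ∷ outside ∷ outside ∷ inside  ∷ outside ∷ []
colours l15 = inside  ∷ outside ∷ outside ∷ outside ∷ inside  ∷ []
colours l23 = outside ∷ inside  ∷ inside  ∷ outside ∷ outside ∷ []
colours l24 = outside ∷ inside  ∷ outside ∷ inside  ∷ outside ∷ []
colours l25 = outside ∷ inside  ∷ outside ∷ outside ∷ inside  ∷ []
colours l34 = outside ∷ outside ∷ inside  ∷ inside  ∷ outside ∷ []
colours l35 = outside ∷ outside ∷ inside  ∷ outside ∷ inside  ∷ []
colours l45 = outside ∷ outside ∷ outside ∷ inside  ∷ inside  ∷ []

∣colours∣≡2 : ∀ l → ∣ colours l ∣ ≡ 2
∣colours∣≡2 = from-yes (all? λ l → ∣ colours l ∣ ≟ℕ 2)

asTwoSubset : Label → TwoSubset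
asTwoSubset l = colours l , ∣colours∣≡2 l

-- Stated through its decision procedure, so that closed instances hold by evaluation.
Covers : Label → Label → Label → Set
Covers a b c = True (⊤ ⊆? colours a ∪ colours b ∪ colours c)

covers? : ∀ a b c → Dec (Covers a b c)
covers? a b c = T? _

covers⇒∈ : ∀ {a b c} → Covers a b c → ∀ i → i ∈ colours a ⊎ i ∈ colours b ⊎ i ∈ colours c
covers⇒∈ {a} {b} {c} h i = Sum.map₂ (x∈p∪q⁻ (colours b) _) (x∈p∪q⁻ (colours a) _ (toWitness h ∈⊤))

covers-resp : ∀ {a b c a′ b′ c′} → a ≡ a′ → b ≡ b′ → c ≡ c′ → Covers a b c → Covers a′ b′ c′
covers-resp refl refl refl h = h

module EdgeGraph (E : ℕ → ℕ → Bool) where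

  Adjacent : ℕ → ℕ → Set
  Adjacent i j = T (E i j ∨ E j i)

  adjacent-sym : ∀ {i j} → Adjacent i j → Adjacent j i
  adjacent-sym {i} {j} = Equivalence.from (T-∨ {E j i}) ∘ Sum.swap ∘ Equivalence.to (T-∨ {E i j})

  Near : ℕ → ℕ → Set
  Near i j = j ≡ i ⊎ Adjacent i j

  near? : ∀ i j → Dec (Near i j)
  near? i j = j ≟ℕ i ⊎-dec T? _

  CoveredBelow : ℕ → (ℕ → Label) → ℕ → Set
  CoveredBelow c g i = ∃ λ j₁ → j₁ < c × Near i j₁ × ∃ λ j₂ → j₂ < c × Near i j₂ × Covers (g j₁) (g i) (g j₂)

  coveredBelow? : ∀ c g i → Dec (CoveredBelow c g i)
  coveredBelow? c g i =
    anyUpTo? (λ j₁ → near? i j₁ ×-dec anyUpTo? (λ j₂ → near? i j₂ ×-dec covers? (g j₁) (g i) (g j₂)) c) c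

  coveredBelow-mono : ∀ {c d g i} → c ≤ d → CoveredBelow c g i → CoveredBelow d g i
  coveredBelow-mono c≤d (j₁ , j₁<c , near₁ , j₂ , j₂<c , h) =
    j₁ , <-≤-trans j₁<c c≤d , near₁ , j₂ , <-≤-trans j₂<c c≤d , h

  coveredBelow-resp : ∀ {c g g′ i} → (∀ {j} → j < c → g j ≡ g′ j) → i < c → CoveredBelow c g i → CoveredBelow c g′ i
  coveredBelow-resp g≡g′ i<c (j₁ , j₁<c , near₁ , j₂ , j₂<c , near₂ , h) =
    j₁ , j₁<c , near₁ , j₂ , j₂<c , near₂ , covers-resp (g≡g′ j₁<c) (g≡g′ i<c) (g≡g′ j₂<c) h

  fromEdgeFun-configurable : ∀ N (g : ℕ → Label) → (∀ {i} → i < N → CoveredBelow N g i) → Configurable (fromEdgeFun N E)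
  fromEdgeFun-configurable N g covered = f , λ v c → witness v c (covered (toℕ<n v))
    where
    f : Fin N → TwoSubset
    f = asTwoSubset ∘ g ∘ toℕ

    Witness : Fin N → Fin 5 → Set
    Witness v c = ∃ λ u → (u ≡ v ⊎ adj (fromEdgeFun N E) v u ≡ true) × c ∈ proj₁ (f u)

    pick : ∀ v c {j} → j < N → Near (toℕ v) j → c ∈ colours (g j) → Witness v c
    pick v c {j} j<N near c∈ = u , near-u near , subst (λ i → c ∈ colours (g i)) (sym toℕu≡j) c∈
      where
      u = fromℕ< j<N
      toℕu≡j : toℕ u ≡ j
      toℕu≡j = toℕ-fromℕ< j<N
      near-u : Near (toℕ v) j → u ≡ v ⊎ adj (fromEdgeFun N E) v u ≡ true
      near-u (inj₁ j≡v) = inj₁ (toℕ-injective (trans toℕu≡j j≡v))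
      near-u (inj₂ adjacent) = inj₂ (Equivalence.to T-≡ (subst (Adjacent (toℕ v)) (sym toℕu≡j) adjacent))

    witness : ∀ v c → CoveredBelow N g (toℕ v) → Witness v c
    witness v c (j₁ , j₁<N , near₁ , j₂ , j₂<N , near₂ , h) with covers⇒∈ h c
    ... | inj₁ c∈ = pick v c j₁<N near₁ c∈
    ... | inj₂ (inj₁ c∈) = pick v c (toℕ<n v) (inj₁ refl) c∈
    ... | inj₂ (inj₂ c∈) = pick v c j₂<N near₂ c∈

module CycPathEdges (m k : ℕ) (x y : Fin m) where
  open EdgeGraph (cycPathEdge m k x y)

  private
    cycleEdge pathEdge startEdge : ℕ → ℕ → Bool
    cycleEdge i j = (i <ᵇ m) ∧ (j ≡ᵇ (if suc i ≡ᵇ m then 0 else suc i))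
    pathEdge i j = (m ≤ᵇ i) ∧ (j ≡ᵇ suc i) ∧ (j <ᵇ (m + k))
    startEdge i j = (i ≡ᵇ m) ∧ (j ≡ᵇ toℕ x)

    ∨-introˡ : ∀ {a} b → T a → T (a ∨ b)
    ∨-introˡ b = Equivalence.from T-∨ ∘ inj₁

    ∨-introʳ : ∀ a {b} → T b → T (a ∨ b)
    ∨-introʳ a = Equivalence.from (T-∨ {a}) ∘ inj₂

    ∧-intro : ∀ {a b} → T a → T b → T (a ∧ b)
    ∧-intro p q = Equivalence.from T-∧ (p , q)

    ≡ᵇ-refl : ∀ n → T (n ≡ᵇ n)
    ≡ᵇ-refl n = ≡⇒≡ᵇ n n refl

    successor-inside : ∀ {i} → suc i < m → (if suc i ≡ᵇ m then 0 else suc i) ≡ suc i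
    successor-inside {i} i+1<m with suc i ≡ᵇ m in eq
    ... | false = refl
    ... | true = contradiction (≡ᵇ⇒≡ (suc i) m (subst T (sym eq) _)) (λ i+1≡m → <-irrefl i+1≡m i+1<m)

    successor-wraps : ∀ {i} → suc i ≡ m → (if suc i ≡ᵇ m then 0 else suc i) ≡ 0
    successor-wraps {i} i+1≡m rewrite Equivalence.to T-≡ (≡⇒≡ᵇ (suc i) m i+1≡m) = refl

    forward : ∀ {i j} → T (cycPathEdge m k x y i j) → Adjacent i j
    forward {i} {j} = ∨-introˡ (cycPathEdge m k x y j i)

  cycle-adjacent : ∀ {i} → suc i < m → Adjacent i (suc i)
  cycle-adjacent {i} i+1<m = forward (∨-introˡ _ (∧-intro (<⇒<ᵇ (<-trans (n<1+n i) i+1<m))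
    (subst (λ j → T (suc i ≡ᵇ j)) (sym (successor-inside i+1<m)) (≡ᵇ-refl (suc i)))))

  cycle-wrap-adjacent : ∀ {i} → suc i ≡ m → Adjacent i 0
  cycle-wrap-adjacent {i} i+1≡m = forward (∨-introˡ _ (∧-intro (<⇒<ᵇ (subst (i <_) i+1≡m (n<1+n i)))
    (subst (λ j → T (0 ≡ᵇ j)) (sym (successor-wraps i+1≡m)) _)))

  path-adjacent : ∀ {i} → m ≤ i → suc i < m + k → Adjacent i (suc i)
  path-adjacent {i} m≤i i+1<m+k = forward (∨-introʳ (cycleEdge i (suc i))
    (∨-introˡ _ (∧-intro (≤⇒≤ᵇ m≤i) (∧-intro (≡ᵇ-refl i) (<⇒<ᵇ i+1<m+k)))))

  start-adjacent : Adjacent m (toℕ x)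
  start-adjacent = forward (∨-introʳ (cycleEdge m (toℕ x)) (∨-introʳ (pathEdge m (toℕ x))
    (∨-introˡ _ (∧-intro (≡ᵇ-refl m) (≡ᵇ-refl (toℕ x))))))

  end-adjacent : Adjacent (m + k ∸ 1) (toℕ y)
  end-adjacent = forward (∨-introʳ (cycleEdge i (toℕ y)) (∨-introʳ (pathEdge i (toℕ y))
    (∨-introʳ (startEdge i (toℕ y)) (∧-intro (≡ᵇ-refl i) (≡ᵇ-refl (toℕ y))))))
    where i = m + k ∸ 1

  cycle-covered : 3 ≤ m → (g : ℕ → Label) → g m ≡ g 0 → g (suc m) ≡ g 1 →
                  (∀ j → Covers (g j) (g (suc j)) (g (suc (suc j)))) →
                  ∀ {i} → i < m → CoveredBelow m g i
  cycle-covered 3≤m g g-m g-m+1 windows {zero} _ =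
    m ∸ 1 , m-1<m , inj₂ (adjacent-sym (cycle-wrap-adjacent 1+[m-1]≡m)) ,
    1 , 1<m , inj₂ (cycle-adjacent 1<m) ,
    covers-resp refl (trans (cong g 1+[m-1]≡m) g-m) (trans (cong (g ∘ suc) 1+[m-1]≡m) g-m+1) (windows (m ∸ 1))
    where
    1<m : 1 < m
    1<m = ≤-trans (s≤s (s≤s z≤n)) 3≤m
    1+[m-1]≡m : suc (m ∸ 1) ≡ m
    1+[m-1]≡m = m+[n∸m]≡n (<⇒≤ 1<m)
    m-1<m : m ∸ 1 < m
    m-1<m = subst (m ∸ 1 <_) 1+[m-1]≡m (n<1+n (m ∸ 1))
  cycle-covered 3≤m g g-m g-m+1 windows {suc i} i+1<m with m≤n⇒m<n∨m≡n i+1<m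
  ... | inj₁ i+2<m = i , <-trans (n<1+n i) i+1<m , inj₂ (adjacent-sym (cycle-adjacent i+1<m)) ,
                     suc (suc i) , i+2<m , inj₂ (cycle-adjacent i+2<m) , windows i
  ... | inj₂ i+2≡m = i , <-trans (n<1+n i) i+1<m , inj₂ (adjacent-sym (cycle-adjacent i+1<m)) ,
                     0 , <-trans z<s i+1<m , inj₂ (cycle-wrap-adjacent i+2≡m) ,
                     covers-resp refl refl (trans (cong g i+2≡m) g-m) (windows i)

Phase : Set
Phase = Fin 5

periodic : Phase → Label
periodic 0F = l12
periodic 1F = l34
periodic 2F = l15
periodic 3F = l23
periodic 4F = l45

next previous : Phase → Phase
next 0F = 1F
next 1F = 2F
next 2F = 3F
next 3F = 4F
next 4F = 0F
previous 0F = 4F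
previous 1F = 0F
previous 2F = 1F
previous 3F = 2F
previous 4F = 3F

previous-next : ∀ a → previous (next a) ≡ a
previous-next = from-yes (all? λ a → previous (next a) ≟ a)

periodic-covers : ∀ a → Covers (periodic a) (periodic (next a)) (periodic (next (next a)))
periodic-covers = from-yes (all? λ a → covers? (periodic a) (periodic (next a)) (periodic (next (next a))))

record Tail (a : Phase) (z : Label) : Set where
  constructor mkTail
  field
    t₁ t₂ t₃ : Label
    entry : Covers (periodic (previous a)) (periodic a) t₁
    covers₁ : Covers (periodic a) t₁ t₂
    covers₂ : Covers t₁ t₂ t₃
    covers₃ : Covers t₂ t₃ z

tail? : ∀ a z → Dec (Tail a z)
tail? a z = map′ (λ (t₁ , t₂ , t₃ , c₀ , c₁ , c₂ , c₃) → mkTail t₁ t₂ t₃ c₀ c₁ c₂ c₃)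
                 (λ (mkTail t₁ t₂ t₃ c₀ c₁ c₂ c₃) → t₁ , t₂ , t₃ , c₀ , c₁ , c₂ , c₃)
  (any? λ t₁ → any? λ t₂ → any? λ t₃ →
     covers? (periodic (previous a)) (periodic a) t₁ ×-dec covers? (periodic a) t₁ t₂ ×-dec
     covers? t₁ t₂ t₃ ×-dec covers? t₂ t₃ z)

opaque
  tail : ∀ a z → Tail a z
  tail = from-yes (all? λ a → all? λ z → tail? a z)

pathWord : Phase → ℕ → Label → ℕ → Label
pathWord a n z zero = periodic a
pathWord a zero z (suc p) = tailWord p
  where
  open Tail (tail a z)
  tailWord : ℕ → Label
  tailWord 0 = t₁
  tailWord 1 = t₂
  tailWord 2 = t₃
  tailWord _ = z
pathWord a (suc n) z (suc p) = pathWord (next a) n z p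

pathWord-last : ∀ a n z → pathWord a n z (n + 4) ≡ z
pathWord-last a zero z = refl
pathWord-last a (suc n) z = pathWord-last (next a) n z

pathWord-covers : ∀ a n z j → j ≤ n + 2 →
  Covers (pathWord a n z j) (pathWord a n z (suc j)) (pathWord a n z (suc (suc j)))
pathWord-covers a zero z 0 _ = Tail.covers₁ (tail a z)
pathWord-covers a zero z 1 _ = Tail.covers₂ (tail a z)
pathWord-covers a zero z 2 _ = Tail.covers₃ (tail a z)
pathWord-covers a zero z (suc (suc (suc j))) (s≤s (s≤s ()))
pathWord-covers a 1 z 0 _ =
  subst (λ b → Covers (periodic b) (periodic (next a)) (Tail.t₁ (tail (next a) z)))
        (previous-next a) (Tail.entry (tail (next a) z))
pathWord-covers a (suc (suc n)) z 0 _ = periodic-covers a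
pathWord-covers a (suc n) z (suc j) (s≤s j≤n+2) = pathWord-covers (next a) n z j j≤n+2

module PathLabelling (m k′ : ℕ) (x y : Fin m) (cyc : ℕ → Label) (a : Phase) where

  k : ℕ
  k = 3 + k′

  open EdgeGraph (cycPathEdge m k x y)
  open CycPathEdges m k x y

  word : ℕ → Label
  word = pathWord a k′ (cyc (toℕ y))

  labelling : ℕ → Label
  labelling i = if i <ᵇ m then cyc i else word (suc (i ∸ m))

  labelling-cycle : ∀ {i} → i < m → labelling i ≡ cyc i
  labelling-cycle {i} i<m rewrite Equivalence.to T-≡ (<⇒<ᵇ i<m) = refl

  labelling-path : ∀ j → labelling (m + j) ≡ word (suc j)
  labelling-path j with m + j <ᵇ m in eq
  ... | true = contradiction (<ᵇ⇒< (m + j) m (subst T (sym eq) _)) (m+n≮m m j)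
  ... | false = cong (word ∘ suc) (m+n∸m≡n m j)

  -- The walk x, v₁, …, v_k, y along the path; vᵢ has index m + i - 1.
  vertex : ℕ → ℕ
  vertex zero = toℕ x
  vertex (suc j) with j <? k
  ... | yes _ = m + j
  ... | no _ = toℕ y

  vertex<m+k : ∀ p → vertex p < m + k
  vertex<m+k zero = <-≤-trans (toℕ<n x) (m≤m+n m k)
  vertex<m+k (suc j) with j <? k
  ... | yes j<k = +-monoʳ-< m j<k
  ... | no _ = <-≤-trans (toℕ<n y) (m≤m+n m k)

  vertex-inner : ∀ {j} → j < k → vertex (suc j) ≡ m + j
  vertex-inner {j} j<k with j <? k
  ... | yes _ = refl
  ... | no j≮k = contradiction j<k j≮k

  vertex-last : vertex (suc k) ≡ toℕ y
  vertex-last with k <? k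
  ... | yes k<k = contradiction k<k (n≮n k)
  ... | no _ = refl

  open ≡-Reasoning

  labelling-vertex : cyc (toℕ x) ≡ periodic a → ∀ p → p ≤ suc k → labelling (vertex p) ≡ word p
  labelling-vertex x-label zero _ = trans (labelling-cycle (toℕ<n x)) x-label
  labelling-vertex x-label (suc j) j<1+k with m≤n⇒m<n∨m≡n (≤-pred j<1+k)
  ... | inj₁ j<k = trans (cong labelling (vertex-inner j<k)) (labelling-path j)
  ... | inj₂ refl = begin
    labelling (vertex (suc k))   ≡⟨ cong labelling vertex-last ⟩
    labelling (toℕ y)            ≡⟨ labelling-cycle (toℕ<n y) ⟩
    cyc (toℕ y)                  ≡⟨ sym (pathWord-last a k′ (cyc (toℕ y))) ⟩
    word (k′ + 4)                ≡⟨ cong word (+-comm k′ 4) ⟩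
    word (suc k)                 ∎

  vertex-adjacent : ∀ p → p < suc k → Adjacent (vertex p) (vertex (suc p))
  vertex-adjacent zero _ = subst (Adjacent (toℕ x)) (sym (trans (vertex-inner (s≤s z≤n)) (+-identityʳ m)))
                                 (adjacent-sym start-adjacent)
  vertex-adjacent (suc j) j<k with m≤n⇒m<n∨m≡n (≤-pred j<k)
  ... | inj₁ j+1<k = subst₂ Adjacent (sym (vertex-inner (<-trans (n<1+n j) j+1<k)))
                                     (sym (trans (vertex-inner j+1<k) (+-suc m j)))
                             (path-adjacent (m≤m+n m j) (subst (_< m + k) (+-suc m j) (+-monoʳ-< m j+1<k)))
  ... | inj₂ refl = subst₂ Adjacent (trans (cong (_∸ 1) (+-suc m j)) (sym (vertex-inner (n<1+n j))))
                                    (sym vertex-last)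
                           end-adjacent

  path-covered : cyc (toℕ x) ≡ periodic a → ∀ {j} → j < k → CoveredBelow (m + k) labelling (m + j)
  path-covered x-label {j} j<k =
    vertex j , vertex<m+k j ,
    inj₂ (subst (λ i → Adjacent i (vertex j)) centre (adjacent-sym (vertex-adjacent j (<-trans j<k (n<1+n k))))) ,
    vertex (2 + j) , vertex<m+k (2 + j) ,
    inj₂ (subst (λ i → Adjacent i (vertex (2 + j))) centre (vertex-adjacent (suc j) (s≤s j<k))) ,
    covers-resp (sym (labelling-vertex x-label j (<⇒≤ (<-trans j<k (n<1+n k)))))
                (sym (labelling-path j))
                (sym (labelling-vertex x-label (2 + j) (s≤s j<k)))
                (pathWord-covers a k′ (cyc (toℕ y)) j (subst (j ≤_) (+-comm 2 k′) (≤-pred j<k)))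
    where
    centre : vertex (suc j) ≡ m + j
    centre = vertex-inner j<k

  configurable : cyc (toℕ x) ≡ periodic a → (∀ {i} → i < m → CoveredBelow (m + k) labelling i) →
                 Configurable (CycPath m k x y)
  configurable x-label cycle-covered = fromEdgeFun-configurable (m + k) labelling covered
    where
    covered : ∀ {i} → i < m + k → CoveredBelow (m + k) labelling i
    covered {i} i<m+k with i <? m
    ... | yes i<m = cycle-covered i<m
    ... | no i≮m = subst (CoveredBelow (m + k) labelling) m+j≡i
                         (path-covered x-label (+-cancelˡ-< m _ _ (subst (_< m + k) (sym m+j≡i) i<m+k)))
      where
      m+j≡i : m + (i ∸ m) ≡ i
      m+j≡i = m+[n∸m]≡n (≮⇒≥ i≮m)

-- In state (a , r) the cycle word is at phase a and still has r short blocks 12 34 15 to insert.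
CycleState : Set
CycleState = Phase × ℕ

step : CycleState → CycleState
step (2F , suc r) = 0F , r
step (a , r) = next a , r

step-covers : ∀ s → Covers (periodic (proj₁ s)) (periodic (proj₁ (step s))) (periodic (proj₁ (step (step s))))
step-covers (0F , r) = _
step-covers (1F , zero) = _
step-covers (1F , suc r) = _
step-covers (2F , zero) = _
step-covers (2F , suc r) = _
step-covers (3F , r) = _
step-covers (4F , r) = _

cycleState : ℕ → ℕ → CycleState
cycleState r = fold (0F , r) step

cycleLabel : ℕ → ℕ → Label
cycleLabel r = periodic ∘ proj₁ ∘ cycleState r

cycleState-returns : ∀ q r → cycleState r (q * 5 + r * 3) ≡ (0F , 0)
cycleState-returns q r = begin
  fold (0F , r) step (q * 5 + r * 3)        ≡⟨ fold-+ (0F , r) step (q * 5) ⟩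
  fold (cycleState r (r * 3)) step (q * 5)  ≡⟨ cong (λ s → fold s step (q * 5)) (short-blocks r) ⟩
  fold (0F , 0) step (q * 5)                ≡⟨ long-blocks q ⟩
  (0F , 0)                                  ∎
  where
  open ≡-Reasoning
  short-blocks : ∀ r → cycleState r (r * 3) ≡ (0F , 0)
  short-blocks zero = refl
  short-blocks (suc r) = trans (cong (cycleState (suc r)) (+-comm 3 (r * 3)))
                               (trans (fold-+ (0F , suc r) step (r * 3)) (short-blocks r))
  long-blocks : ∀ q → fold (0F , 0) step (q * 5) ≡ (0F , 0)
  long-blocks zero = refl
  long-blocks (suc q) = trans (cong (fold (0F , 0) step) (+-comm 5 (q * 5)))
                              (trans (fold-+ (0F , 0) step (q * 5)) (long-blocks q))

periodic-configurable : ∀ q r k′ → let m = q * 5 + r * 3 in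
  3 ≤ m → (x y : Fin m) → Configurable (CycPath m (3 + k′) x y)
periodic-configurable q r k′ 3≤m x y = configurable refl λ {i} i<m →
  coveredBelow-mono (m≤m+n m k)
    (coveredBelow-resp (sym ∘ labelling-cycle) i<m
      (cycle-covered 3≤m (cycleLabel r) wraps (cong (periodic ∘ proj₁ ∘ step) returns)
        (step-covers ∘ cycleState r) i<m))
  where
  m = q * 5 + r * 3
  open PathLabelling m k′ x y (cycleLabel r) (proj₁ (cycleState r (toℕ x)))
  open EdgeGraph (cycPathEdge m k x y)
  open CycPathEdges m k x y
  returns : cycleState r m ≡ (0F , 0)
  returns = cycleState-returns q r
  wraps : cycleLabel r m ≡ cycleLabel r 0
  wraps = cong (periodic ∘ proj₁) returns

fives-and-threes : ∀ n → ∃₂ λ q r → 8 + n ≡ q * 5 + r * 3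
fives-and-threes 0 = 1 , 1 , refl
fives-and-threes 1 = 0 , 3 , refl
fives-and-threes 2 = 2 , 0 , refl
fives-and-threes 3 = 1 , 2 , refl
fives-and-threes 4 = 0 , 4 , refl
fives-and-threes (suc (suc (suc (suc (suc n))))) with fives-and-threes n
... | q , r , eq = suc q , r , trans (cong (5 +_) eq) (sym (+-assoc 5 (q * 5) (r * 3)))

data CycleLength : ℕ → Set where
  blocks : ∀ q r → CycleLength (q * 5 + r * 3)
  four : CycleLength 4
  seven : CycleLength 7

cycleLength : ∀ m → 3 ≤ m → CycleLength m
cycleLength 0 ()
cycleLength 1 (s≤s ())
cycleLength 2 (s≤s (s≤s ()))
cycleLength 3 _ = blocks 0 1
cycleLength 4 _ = four
cycleLength 5 _ = blocks 1 0
cycleLength 6 _ = blocks 0 2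
cycleLength 7 _ = seven
cycleLength (suc (suc (suc (suc (suc (suc (suc (suc n)))))))) _ with fives-and-threes n
... | q , r , eq = subst CycleLength (sym eq) (blocks q r)

-- w rotated so that its first letter sits at vertex x
rotate : ∀ {m} .{{_ : NonZero m}} → Vec Label m → Fin m → ℕ → Label
rotate {m} w x i = lookup w ((i + (m ∸ toℕ x)) mod m)

module ShortCycle (m : ℕ) .{{_ : NonZero m}} (w : Vec Label m) where

  longLabelling : ℕ → Fin m → Fin m → ℕ → Label
  longLabelling k″ x y = PathLabelling.labelling m (suc k″) x y (rotate w x) 0F

  -- Only the cycle and the first path vertex are inspected, so the check evaluates for symbolic k″ and y.
  LongCycleCovered : ℕ → Fin m → Fin m → Set
  LongCycleCovered k″ x y =
    ∀ {i} → i < m → EdgeGraph.CoveredBelow (cycPathEdge m (4 + k″) x y) (m + 1) (longLabelling k″ x y) i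

  startsWith12? : Dec (∀ x → rotate w x (toℕ x) ≡ periodic 0F)
  startsWith12? = all? λ x → rotate w x (toℕ x) ≟ periodic 0F

  longCycleCovered? : ∀ k″ y → Dec (∀ x → LongCycleCovered k″ x y)
  longCycleCovered? k″ y = all? λ x →
    allUpTo? (EdgeGraph.coveredBelow? (cycPathEdge m (4 + k″) x y) (m + 1) (longLabelling k″ x y)) m

  long-configurable : True startsWith12? → (∀ k″ y → True (longCycleCovered? k″ y)) →
                      ∀ k″ x y → Configurable (CycPath m (4 + k″) x y)
  long-configurable starts covered k″ x y =
    configurable (toWitness starts x) λ i<m →
      coveredBelow-mono (+-monoʳ-≤ m (s≤s z≤n)) (toWitness (covered k″ y) x i<m)
    where
    open PathLabelling m (suc k″) x y (rotate w x) 0F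
    open EdgeGraph (cycPathEdge m (4 + k″) x y)

  shortLabelling : Fin m → Label → Label → Label → ℕ → Label
  shortLabelling x t₁ t₂ t₃ i = if i <ᵇ m then rotate w x i else pathLabel (i ∸ m)
    where
    pathLabel : ℕ → Label
    pathLabel 0 = t₁
    pathLabel 1 = t₂
    pathLabel _ = t₃

  -- The three path windows follow from the last conjunct; listed first, they prune the search.
  ShortPathExists : Fin m → Fin m → Set
  ShortPathExists x y = ∃ λ t₁ → ∃ λ t₂ → ∃ λ t₃ →
    Covers (rotate w x (toℕ x)) t₁ t₂ × Covers t₁ t₂ t₃ × Covers t₂ t₃ (rotate w x (toℕ y)) ×
    ∀ {i} → i < m + 3 → EdgeGraph.CoveredBelow (cycPathEdge m 3 x y) (m + 3) (shortLabelling x t₁ t₂ t₃) i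

  shortPathExists? : ∀ x y → Dec (ShortPathExists x y)
  shortPathExists? x y = any? λ t₁ → any? λ t₂ → any? λ t₃ →
    covers? _ t₁ t₂ ×-dec covers? t₁ t₂ t₃ ×-dec covers? t₂ t₃ _ ×-dec
    allUpTo? (EdgeGraph.coveredBelow? (cycPathEdge m 3 x y) (m + 3) (shortLabelling x t₁ t₂ t₃)) (m + 3)

  short-configurable : ∀ {x y} → ShortPathExists x y → Configurable (CycPath m 3 x y)
  short-configurable {x} {y} (t₁ , t₂ , t₃ , _ , _ , _ , covered) =
    EdgeGraph.fromEdgeFun-configurable (cycPathEdge m 3 x y) (m + 3) (shortLabelling x t₁ t₂ t₃) covered

IsIsomorphism : (G H : Graph) → (Fin (n G) → Fin (n H)) → Set
IsIsomorphism G H σ = (∀ u v → σ u ≡ σ v → u ≡ v) × (∀ v → ∃ λ u → σ u ≡ v) ×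
                      (∀ u v → adj G u v ≡ adj H (σ u) (σ v))

isIsomorphism? : ∀ G H σ → Dec (IsIsomorphism G H σ)
isIsomorphism? G H σ =
  all? (λ u → all? λ v → (σ u ≟ σ v) →-dec (u ≟ v)) ×-dec
  all? (λ v → any? λ u → σ u ≟ v) ×-dec
  all? (λ u → all? λ v → adj G u v ≟ᴮ adj H (σ u) (σ v))

≅-from-table : ∀ G H (σ : Vec (Fin (n H)) (n G)) → True (isIsomorphism? G H (lookup σ)) → G ≅ H
≅-from-table G H σ iso with toWitness iso
... | injective , surjective , preserves =
  mk⤖ ((λ {u} {v} → injective u v) , strictlySurjective⇒surjective surjective) , preserves

base₄ : Vec Label 4
base₄ = l12 ∷ l15 ∷ l34 ∷ l25 ∷ []

module C₄ = ShortCycle 4 base₄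

C₄+P₃ : Fin 4 → Fin 4 → Graph
C₄+P₃ = CycPath 4 3

C₄+P₃-classification : ∀ x y → C₄+P₃ x y ≅ C4·C4 ⊎ C₄+P₃ x y ≅ G₁ ⊎ Configurable (C₄+P₃ x y)
C₄+P₃-classification 0F 0F = inj₁ (≅-from-table (C₄+P₃ 0F 0F) C4·C4 (0F ∷ 1F ∷ 2F ∷ 3F ∷ 4F ∷ 5F ∷ 6F ∷ []) _)
C₄+P₃-classification 0F 1F = inj₂ (inj₁ (≅-from-table (C₄+P₃ 0F 1F) G₁ (2F ∷ 5F ∷ 4F ∷ 3F ∷ 1F ∷ 0F ∷ 6F ∷ []) _))
C₄+P₃-classification 0F 2F = inj₂ (inj₂ (C₄.short-configurable (from-yes (C₄.shortPathExists? 0F 2F))))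
C₄+P₃-classification 0F 3F = inj₂ (inj₁ (≅-from-table (C₄+P₃ 0F 3F) G₁ (2F ∷ 3F ∷ 4F ∷ 5F ∷ 1F ∷ 0F ∷ 6F ∷ []) _))
C₄+P₃-classification 1F 0F = inj₂ (inj₁ (≅-from-table (C₄+P₃ 1F 0F) G₁ (2F ∷ 5F ∷ 4F ∷ 3F ∷ 6F ∷ 0F ∷ 1F ∷ []) _))
C₄+P₃-classification 1F 1F = inj₁ (≅-from-table (C₄+P₃ 1F 1F) C4·C4 (1F ∷ 0F ∷ 3F ∷ 2F ∷ 4F ∷ 5F ∷ 6F ∷ []) _)
C₄+P₃-classification 1F 2F = inj₂ (inj₁ (≅-from-table (C₄+P₃ 1F 2F) G₁ (3F ∷ 2F ∷ 5F ∷ 4F ∷ 1F ∷ 0F ∷ 6F ∷ []) _))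
C₄+P₃-classification 1F 3F = inj₂ (inj₂ (C₄.short-configurable (from-yes (C₄.shortPathExists? 1F 3F))))
C₄+P₃-classification 2F 0F = inj₂ (inj₂ (C₄.short-configurable (from-yes (C₄.shortPathExists? 2F 0F))))
C₄+P₃-classification 2F 1F = inj₂ (inj₁ (≅-from-table (C₄+P₃ 2F 1F) G₁ (3F ∷ 2F ∷ 5F ∷ 4F ∷ 6F ∷ 0F ∷ 1F ∷ []) _))
C₄+P₃-classification 2F 2F = inj₁ (≅-from-table (C₄+P₃ 2F 2F) C4·C4 (2F ∷ 1F ∷ 0F ∷ 3F ∷ 4F ∷ 5F ∷ 6F ∷ []) _)
C₄+P₃-classification 2F 3F = inj₂ (inj₁ (≅-from-table (C₄+P₃ 2F 3F) G₁ (3F ∷ 4F ∷ 5F ∷ 2F ∷ 6F ∷ 0F ∷ 1F ∷ []) _))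
C₄+P₃-classification 3F 0F = inj₂ (inj₁ (≅-from-table (C₄+P₃ 3F 0F) G₁ (2F ∷ 3F ∷ 4F ∷ 5F ∷ 6F ∷ 0F ∷ 1F ∷ []) _))
C₄+P₃-classification 3F 1F = inj₂ (inj₂ (C₄.short-configurable (from-yes (C₄.shortPathExists? 3F 1F))))
C₄+P₃-classification 3F 2F = inj₂ (inj₁ (≅-from-table (C₄+P₃ 3F 2F) G₁ (3F ∷ 4F ∷ 5F ∷ 2F ∷ 1F ∷ 0F ∷ 6F ∷ []) _))
C₄+P₃-classification 3F 3F = inj₁ (≅-from-table (C₄+P₃ 3F 3F) C4·C4 (1F ∷ 2F ∷ 3F ∷ 0F ∷ 4F ∷ 5F ∷ 6F ∷ []) _)

base₇ : Vec Label 7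
base₇ = l12 ∷ l13 ∷ l45 ∷ l23 ∷ l12 ∷ l45 ∷ l35 ∷ []

module C₇ = ShortCycle 7 base₇

C₇-configurable : ∀ k′ (x y : Fin 7) → Configurable (CycPath 7 (3 + k′) x y)
C₇-configurable zero x y = C₇.short-configurable (from-yes (all? λ x → all? λ y → C₇.shortPathExists? x y) x y)
C₇-configurable (suc k″) = C₇.long-configurable _ (λ _ _ → _) k″

C₄-configurable : ∀ k′ (x y : Fin 4) → ¬ CycPath 4 (3 + k′) x y ≅ C4·C4 → ¬ CycPath 4 (3 + k′) x y ≅ G₁ →
                  Configurable (CycPath 4 (3 + k′) x y)
C₄-configurable zero x y ≇C4·C4 ≇G₁ with C₄+P₃-classification x y
... | inj₁ ≅C4·C4 = contradiction ≅C4·C4 ≇C4·C4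
... | inj₂ (inj₁ ≅G₁) = contradiction ≅G₁ ≇G₁
... | inj₂ (inj₂ configurable) = configurable
C₄-configurable (suc k″) x y _ _ = C₄.long-configurable _ (λ _ _ → _) k″ x y

lemma2p8 : (m k : ℕ) → 3 ≤ m → 3 ≤ k → (x y : Fin m) →
    ¬ (CycPath m k x y ≅ C4·C4) → ¬ (CycPath m k x y ≅ G₁) →
    Configurable (CycPath m k x y)
lemma2p8 m (suc (suc (suc k′))) 3≤m (s≤s (s≤s (s≤s _))) x y ≇C4·C4 ≇G₁ with cycleLength m 3≤m
... | blocks q r = periodic-configurable q r k′ 3≤m x y
... | four = C₄-configurable k′ x y ≇C4·C4 ≇G₁
... | seven = C₇-configurable k′ x y
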